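{- Let $A\subseteq\mathbb N$ be a c.e. set whose complement is infinite. Then $\omega\leq F_A$ if and only if $A$ is not hypersimple.
   Context: A ceer is an equivalence relation on $\mathbb N$ c.e. as a subset of $\mathbb N^2$; $R_1\leq R_2$ means there is a total computable $f$ with $xR_1y\Leftrightarrow f(x)R_2f(y)$. $\omega$ is the identity relation on $\mathbb N$. For c.e. $A$, $xF_Ay\Leftrightarrow x=y\lor\forall z(\min(x,y)\leq z\leq\max(x,y)\to z\in A)$. A c.e. set $A$ is hypersimple if its complement is infinite and no computable total $f$ satisfies $f(n)\geq z_n$ for all $n$, where $z_0<z_1<\cdots$ enumerates $\mathbb N\setminus A$. -}

module Defs where

open import Data.Nat using (ℕ; zero; suc; _≤_; _<_)
open import Data.Fin using (Fin)
open import Data.Vec using (Vec; []; _∷_; lookup)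
open import Data.Product using (Σ; _×_; _,_)
open import Data.Sum using (_⊎_)
open import Relation.Nullary using (¬_)
open import Relation.Binary.PropositionalEquality using (_≡_)
open import Function.Bundles using (_⇔_)

data Code : ℕ → Set where
  cz   : ∀ {n} → Code n
  cs   : Code 1
  cp   : ∀ {n} → Fin n → Code n
  comp : ∀ {n m} → Code m → Vec (Code n) m → Code n
  prec : ∀ {n} → Code n → Code (suc (suc n)) → Code (suc n)
  mu   : ∀ {n} → Code (suc n) → Code n

mutual
  data _∙_⇓_ : ∀ {n} → Code n → Vec ℕ n → ℕ → Set where
    ev-z    : ∀ {n} {xs : Vec ℕ n} → cz ∙ xs ⇓ 0
    ev-s    : ∀ {x} → cs ∙ (x ∷ []) ⇓ suc x
    ev-p    : ∀ {n} {i : Fin n} {xs} → cp i ∙ xs ⇓ lookup xs i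
    ev-comp : ∀ {n m} {f : Code m} {gs : Vec (Code n) m} {xs ys y} →
              gs ∙* xs ⇓ ys → f ∙ ys ⇓ y → comp f gs ∙ xs ⇓ y
    ev-prec0 : ∀ {n} {g : Code n} {h : Code (suc (suc n))} {xs y} →
               g ∙ xs ⇓ y → prec g h ∙ (0 ∷ xs) ⇓ y
    ev-precS : ∀ {n} {g : Code n} {h : Code (suc (suc n))} {k xs r y} →
               prec g h ∙ (k ∷ xs) ⇓ r → h ∙ (k ∷ r ∷ xs) ⇓ y →
               prec g h ∙ (suc k ∷ xs) ⇓ y
    ev-mu   : ∀ {n} {f : Code (suc n)} {xs y} →
              f ∙ (y ∷ xs) ⇓ 0 →
              (∀ z → z < y → Σ ℕ (λ k → f ∙ (z ∷ xs) ⇓ suc k)) →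
              mu f ∙ xs ⇓ y

  data _∙*_⇓_ : ∀ {n m} → Vec (Code n) m → Vec ℕ n → Vec ℕ m → Set where
    ev-[] : ∀ {n} {xs : Vec ℕ n} → [] ∙* xs ⇓ []
    ev-∷  : ∀ {n m} {g : Code n} {gs : Vec (Code n) m} {xs y ys} →
            g ∙ xs ⇓ y → gs ∙* xs ⇓ ys → (g ∷ gs) ∙* xs ⇓ (y ∷ ys)

Computable : (ℕ → ℕ) → Set
Computable f = Σ (Code 1) λ e → ∀ n → e ∙ (n ∷ []) ⇓ f n

CE : (ℕ → Set) → Set
CE A = Σ (Code 1) λ e → ∀ x → A x ⇔ Σ ℕ (λ y → e ∙ (x ∷ []) ⇓ y)

CE₂ : (ℕ → ℕ → Set) → Set
CE₂ R = Σ (Code 2) λ e → ∀ x y → R x y ⇔ Σ ℕ (λ v → e ∙ (x ∷ y ∷ []) ⇓ v)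

Rel₀ : Set₁
Rel₀ = ℕ → ℕ → Set

_≤ᶜ_ : Rel₀ → Rel₀ → Set
R₁ ≤ᶜ R₂ = Σ (ℕ → ℕ) λ f → Computable f × (∀ x y → R₁ x y ⇔ R₂ (f x) (f y))

ω : Rel₀
ω x y = x ≡ y

-- F_A : x F_A y ⇔ x = y ∨ ∀ z (min(x,y) ≤ z ≤ max(x,y) → z ∈ A).
-- (min(x,y) ≤ z ≤ max(x,y) written without min/max: z lies between x and y.)
F : (ℕ → Set) → Rel₀
F A x y = x ≡ y ⊎ (∀ z → ((x ≤ z × z ≤ y) ⊎ (y ≤ z × z ≤ x)) → A z)

CoInfinite : (ℕ → Set) → Set
CoInfinite A = ∀ n → Σ ℕ λ m → n ≤ m × ¬ A m

-- NthCompl A n z : z = z_n, the n-th element (from 0) of ℕ ∖ A in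
-- increasing order z₀ < z₁ < ⋯.
data NthCompl (A : ℕ → Set) : ℕ → ℕ → Set where
  nth-zero : ∀ {z} → ¬ A z → (∀ w → w < z → A w) → NthCompl A 0 z
  nth-suc  : ∀ {n z' z} → NthCompl A n z' → z' < z → ¬ A z →
             (∀ w → z' < w → w < z → A w) → NthCompl A (suc n) z

Dominates : (ℕ → Set) → (ℕ → ℕ) → Set
Dominates A f = ∀ n z → NthCompl A n z → z ≤ f n

Hypersimple : (ℕ → Set) → Set
Hypersimple A = CoInfinite A × ¬ (Σ (ℕ → ℕ) λ f → Computable f × Dominates A f)

-- "A is not hypersimple", for co-infinite A, in its positive (classically
-- equivalent) form: some total computable f satisfies f n ≥ z_n for all n.
-- (Classically ¬ Hypersimple A ⇔ ¬ CoInfinite A ⊎ NotHypersimple A.)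
NotHypersimple : (ℕ → Set) → Set
NotHypersimple A = Σ (ℕ → ℕ) λ f → Computable f × Dominates A f

module Submission where

-- (⇒) Below z_n the complement has only the n points z₀, …, z_{n-1}, so
--     [0, z_n) splits into at most 2n+1 F_A-classes: the n points and
--     the n+1 gaps between them, each gap an interval inside A.  A
--     reduction f of ω to F_A sends 0, …, 2n+1 to pairwise
--     F_A-inequivalent numbers, so by the pigeonhole principle one of
--     them is ≥ z_n; hence  n ↦ f 0 + ⋯ + f (2n+1)  dominates (z_n).
-- (⇐) If a computable g dominates (z_n), then z_{x+1} lies in
--     (x, g (x+1)].  Iterating x ↦ g (x+1) from 0 gives a computable
--     sequence with a complement point between any two consecutive
--     terms, so distinct terms are F_A-inequivalent: a reduction.

open import Defs
open import Data.Nat using (ℕ; zero; suc; _+_; _∸_; _≤_; _<_; z≤n; s≤s; s≤s⁻¹; _≤?_)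
open import Data.Nat.Properties
open import Data.Nat.GeneralisedArithmetic using (fold)
open import Data.Fin using (Fin; toℕ; fromℕ<) renaming (zero to fzero; suc to fsuc)
open import Data.Fin.Properties using (<⇒notInjective; toℕ-injective; toℕ-fromℕ<; toℕ<n)
open import Data.Vec using (Vec; []; _∷_)
open import Data.Product using (Σ; _×_; _,_)
open import Data.Sum using (inj₁; inj₂)
open import Data.Empty using (⊥; ⊥-elim)
open import Function.Base using (_∘_)
open import Function.Bundles using (_⇔_; mk⇔; Equivalence)
open import Relation.Nullary using (¬_; yes; no)
open import Relation.Nullary.Decidable using (decidable-stable; ¬¬-excluded-middle)
open import Relation.Binary.PropositionalEquality using (_≡_; refl; sym; trans; cong; subst)
open import Relation.Binary.Definitions using (tri<; tri≈; tri>)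

constCode : ∀ {k} → ℕ → Code k
constCode zero    = cz
constCode (suc c) = comp cs (constCode c ∷ [])

constCode-eval : ∀ {k} c (xs : Vec ℕ k) → constCode c ∙ xs ⇓ c
constCode-eval zero    xs = ev-z
constCode-eval (suc c) xs = ev-comp (ev-∷ (constCode-eval c xs) ev-[]) ev-s

addCode : Code 2
addCode = prec (cp fzero) (comp cs (cp (fsuc fzero) ∷ []))

addCode-eval : ∀ a b → addCode ∙ (a ∷ b ∷ []) ⇓ (a + b)
addCode-eval zero    b = ev-prec0 ev-p
addCode-eval (suc a) b = ev-precS (addCode-eval a b) (ev-comp (ev-∷ ev-p ev-[]) ev-s)

computable-suc : Computable suc
computable-suc = cs , λ n → ev-s

computable-∘ : ∀ {f g : ℕ → ℕ} → Computable f → Computable g → Computable (f ∘ g)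
computable-∘ {g = g} (e , e-eval) (d , d-eval) =
  comp e (d ∷ []) , λ n → ev-comp (ev-∷ (d-eval n) ev-[]) (e-eval (g n))

computable-fold : ∀ {s : ℕ → ℕ} z → Computable s → Computable (fold z s)
computable-fold {s} z (e , e-eval) = code , eval
  where
  code : Code 1
  code = prec (constCode z) (comp e (cp (fsuc fzero) ∷ []))

  eval : ∀ n → code ∙ (n ∷ []) ⇓ fold z s n
  eval zero    = ev-prec0 (constCode-eval z [])
  eval (suc n) = ev-precS (eval n) (ev-comp (ev-∷ ev-p ev-[]) (e-eval _))

sumBelow : (ℕ → ℕ) → ℕ → ℕ
sumBelow f zero    = 0
sumBelow f (suc k) = sumBelow f k + f k

term≤sumBelow : ∀ (f : ℕ → ℕ) {i k} → i < k → f i ≤ sumBelow f k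
term≤sumBelow f {i} {suc k} (s≤s i≤k) with m≤n⇒m<n∨m≡n i≤k
... | inj₁ i<k  = ≤-trans (term≤sumBelow f i<k) (m≤m+n _ _)
... | inj₂ refl = m≤n+m _ _

computable-sumBelow : ∀ {f : ℕ → ℕ} → Computable f → Computable (sumBelow f)
computable-sumBelow {f} (e , e-eval) = code , eval
  where
  code : Code 1
  code = prec cz (comp addCode (cp (fsuc fzero) ∷ comp e (cp fzero ∷ []) ∷ []))

  eval : ∀ k → code ∙ (k ∷ []) ⇓ sumBelow f k
  eval zero    = ev-prec0 ev-z
  eval (suc k) = ev-precS (eval k)
    (ev-comp (ev-∷ ev-p (ev-∷ (ev-comp (ev-∷ ev-p ev-[]) (e-eval k)) ev-[]))
             (addCode-eval _ _))

stepwise-monotone : ∀ (h : ℕ → ℕ) → (∀ n → h n ≤ h (suc n)) → ∀ {m n} → m ≤ n → h m ≤ h n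
stepwise-monotone h step {n = zero}  z≤n = ≤-refl
stepwise-monotone h step {n = suc n} m≤1+n with m≤n⇒m<n∨m≡n m≤1+n
... | inj₁ m<1+n = ≤-trans (stepwise-monotone h step (s≤s⁻¹ m<1+n)) (step n)
... | inj₂ refl  = ≤-refl

module Complement (A : ℕ → Set) where

  F-sym : ∀ {a b} → F A a b → F A b a
  F-sym (inj₁ a≡b)     = inj₁ (sym a≡b)
  F-sym (inj₂ between) = inj₂ λ w → λ { (inj₁ w∈ab) → between w (inj₂ w∈ab)
                                      ; (inj₂ w∈ba) → between w (inj₁ w∈ba) }

  interval⇒F : ∀ {a b} → a ≤ b → (∀ w → a ≤ w → w ≤ b → A w) → F A a b
  interval⇒F a≤b inA = inj₂ λ w → λ
    { (inj₁ (a≤w , w≤b)) → inA w a≤w w≤b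
    ; (inj₂ (b≤w , w≤a)) → inA w (≤-trans a≤b b≤w) (≤-trans w≤a a≤b) }

  gap⇒¬F : ∀ {a b c} → a < c → c ≤ b → ¬ A c → ¬ F A a b
  gap⇒¬F a<c c≤a nc (inj₁ refl) = <⇒≱ a<c c≤a
  gap⇒¬F a<c c≤b nc (inj₂ inA)  = nc (inA _ (inj₁ (<⇒≤ a<c , c≤b)))

  LeastOutsideFrom : ℕ → ℕ → Set
  LeastOutsideFrom b w = b ≤ w × ¬ A w × (∀ u → b ≤ u → u < w → A u)

  -- A point of ℕ ∖ A above b yields (up to double negation) the least one,
  -- by scanning upwards from b with excluded middle for each A u.
  least-outside : ∀ {b m} → b ≤ m → ¬ A m → ¬ ¬ Σ ℕ (LeastOutsideFrom b)
  least-outside {b} {m} b≤m m∉A =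
    scan b (m ∸ b) (subst (¬_ ∘ A) (sym (m+[n∸m]≡n b≤m)) m∉A)
    where
    nothing-below : ∀ c u → c ≤ u → u < c → A u
    nothing-below c u c≤u u<c = ⊥-elim (<⇒≱ u<c c≤u)

    scan : ∀ c k → ¬ A (c + k) → ¬ ¬ Σ ℕ (LeastOutsideFrom c)
    scan c zero c∉A none =
      none (c , ≤-refl , subst (¬_ ∘ A) (+-identityʳ c) c∉A , nothing-below c)
    scan c (suc k) c+k+1∉A none = ¬¬-excluded-middle λ
      { (no c∉A)  → none (c , ≤-refl , c∉A , nothing-below c)
      ; (yes c∈A) → scan (suc c) k (subst (¬_ ∘ A) (+-suc c k) c+k+1∉A)
          λ { (w , c<w , w∉A , below) →
                none (w , <⇒≤ c<w , w∉A , extend c∈A below) } }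
      where
      extend : A c → ∀ {w} → (∀ u → suc c ≤ u → u < w → A u) → ∀ u → c ≤ u → u < w → A u
      extend c∈A below u c≤u u<w with m≤n⇒m<n∨m≡n c≤u
      ... | inj₁ c<u  = below u c<u u<w
      ... | inj₂ refl = c∈A

  complement-enumerated : CoInfinite A → ∀ n → ¬ ¬ Σ ℕ (NthCompl A n)
  complement-enumerated coinf zero none with coinf 0
  ... | m , _ , m∉A = least-outside z≤n m∉A
          λ { (w , _ , w∉A , below) → none (w , nth-zero w∉A λ u → below u z≤n) }
  complement-enumerated coinf (suc n) none =
    complement-enumerated coinf n λ { (z , zₙ) → next zₙ (coinf (suc z)) }
    where
    next : ∀ {z} → NthCompl A n z → Σ ℕ (λ m → suc z ≤ m × ¬ A m) → ⊥
    next zₙ (m , z<m , m∉A) = least-outside z<m m∉A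
      λ { (w , z<w , w∉A , below) → none (w , nth-suc zₙ z<w w∉A below) }

  nth-lower-bound : ∀ {n z} → NthCompl A n z → n ≤ z
  nth-lower-bound (nth-zero _ _)         = z≤n
  nth-lower-bound (nth-suc zₙ zₙ<z _ _) = ≤-trans (s≤s (nth-lower-bound zₙ)) zₙ<z

  nth-outside : ∀ {n z} → NthCompl A n z → ¬ A z
  nth-outside (nth-zero z∉A _)    = z∉A
  nth-outside (nth-suc _ _ z∉A _) = z∉A

  -- If g dominates (z_n), then ℕ ∖ A meets (x, g (x+1)], namely at z_{x+1}.
  dominator-gap : CoInfinite A → ∀ {g} → Dominates A g →
                  ∀ x → ¬ ¬ Σ ℕ λ z → x < z × z ≤ g (suc x) × ¬ A z
  dominator-gap coinf dom x none = complement-enumerated coinf (suc x)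
    λ { (z , zₓ₊₁) → none (z , nth-lower-bound zₓ₊₁ , dom _ z zₓ₊₁ , nth-outside zₓ₊₁) }

-- classBound n = 2n+1, the number of F_A-classes meeting [0, z_n).
classBound : ℕ → ℕ
classBound = fold 1 (suc ∘ suc)

module Classes (A : ℕ → Set) where
  open Complement A

  -- A label for each v < z_n: the gap below z₀ gets 0; passing z_{n-1}
  -- adds the labels 2n-1 (for z_{n-1} itself) and 2n (for the gap above).
  label : ∀ {n z} → NthCompl A n z → ℕ → ℕ
  label (nth-zero _ _) v = 0
  label (nth-suc {n} {z'} zₙ _ _ _) v with <-cmp v z'
  ... | tri< _ _ _ = label zₙ v
  ... | tri≈ _ _ _ = classBound n
  ... | tri> _ _ _ = suc (classBound n)

  label-bound : ∀ {n z} (p : NthCompl A n z) v → v < z → label p v < classBound n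
  label-bound (nth-zero _ _) v _ = s≤s z≤n
  label-bound (nth-suc {n} {z'} zₙ _ _ _) v v<z with <-cmp v z'
  ... | tri< v<z' _ _ = ≤-trans (label-bound zₙ v v<z') (≤-trans (n≤1+n _) (n≤1+n _))
  ... | tri≈ _ _ _    = n≤1+n _
  ... | tri> _ _ _    = ≤-refl

  same-label⇒inside : ∀ {n z} (p : NthCompl A n z) {x y} → x < y → y < z →
                      label p x ≡ label p y → ∀ w → x ≤ w → w ≤ y → A w
  same-label⇒inside (nth-zero _ below) x<y y<z _ w _ w≤y = below w (≤-<-trans w≤y y<z)
  same-label⇒inside (nth-suc {n} {z'} zₙ _ _ between) {x} {y} x<y y<z same w x≤w w≤y
    with <-cmp x z' | <-cmp y z'
  ... | tri< _ _ _    | tri< y<z' _ _ = same-label⇒inside zₙ x<y y<z' same w x≤w w≤y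
  ... | tri< x<z' _ _ | tri≈ _ _ _    = ⊥-elim (<-irrefl same (label-bound zₙ x x<z'))
  ... | tri< x<z' _ _ | tri> _ _ _    =
        ⊥-elim (<-irrefl same (≤-trans (label-bound zₙ x x<z') (n≤1+n _)))
  ... | tri≈ _ refl _ | tri< y<x _ _  = ⊥-elim (<-asym x<y y<x)
  ... | tri≈ _ refl _ | tri≈ _ refl _ = ⊥-elim (<-irrefl refl x<y)
  ... | tri≈ _ _ _    | tri> _ _ _    = ⊥-elim (<-irrefl same (n<1+n _))
  ... | tri> _ _ z'<x | tri< y<z' _ _ = ⊥-elim (<-asym (<-trans x<y y<z') z'<x)
  ... | tri> _ _ z'<x | tri≈ _ refl _ = ⊥-elim (<-asym x<y z'<x)
  ... | tri> _ _ z'<x | tri> _ _ _    = between w (<-≤-trans z'<x x≤w) (≤-<-trans w≤y y<z)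

  same-label⇒F : ∀ {n z} (p : NthCompl A n z) {x y} → x < z → y < z →
                 label p x ≡ label p y → F A x y
  same-label⇒F p {x} {y} x<z y<z same with <-cmp x y
  ... | tri< x<y _ _ = interval⇒F (<⇒≤ x<y) (same-label⇒inside p x<y y<z same)
  ... | tri≈ _ x≡y _ = inj₁ x≡y
  ... | tri> _ _ y<x = F-sym (interval⇒F (<⇒≤ y<x) (same-label⇒inside p y<x x<z (sym same)))

module Forward (A : ℕ → Set) {f : ℕ → ℕ} (reflects : ∀ x y → F A (f x) (f y) → x ≡ y) where
  open Classes A

  -- Pigeonhole: f 0, …, f (2n+1) cannot all lie below z_n, since their
  -- labels would give an injection of 2n+2 points into 2n+1 labels.
  reduction-escapes : ∀ {n z} → NthCompl A n z →
                      ¬ (∀ i → i < suc (classBound n) → f i < z)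
  reduction-escapes {n} {z} p below = <⇒notInjective (n<1+n _) labelled-injective
    where
    f<z : (i : Fin (suc (classBound n))) → f (toℕ i) < z
    f<z i = below (toℕ i) (toℕ<n i)

    labelled : Fin (suc (classBound n)) → Fin (classBound n)
    labelled i = fromℕ< (label-bound p (f (toℕ i)) (f<z i))

    labelled-injective : ∀ {i j} → labelled i ≡ labelled j → i ≡ j
    labelled-injective {i} {j} same = toℕ-injective (reflects _ _
      (same-label⇒F p (f<z i) (f<z j)
        (trans (sym (toℕ-fromℕ< _)) (trans (cong toℕ same) (toℕ-fromℕ< _)))))

  dominator : ℕ → ℕ
  dominator = sumBelow f ∘ suc ∘ classBound

  dominates : Dominates A dominator
  dominates n z zₙ = decidable-stable (z ≤? dominator n) λ z≰ →
    reduction-escapes zₙ λ i i≤2n+1 → ≤-<-trans (term≤sumBelow f i≤2n+1) (≰⇒> z≰)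

  computable-dominator : Computable f → Computable dominator
  computable-dominator f-computable =
    computable-∘ (computable-sumBelow f-computable)
      (computable-∘ computable-suc
        (computable-fold 1 (computable-∘ computable-suc computable-suc)))

module Backward (A : ℕ → Set) (coinf : CoInfinite A) {g : ℕ → ℕ} (dom : Dominates A g) where
  open Complement A

  r : ℕ → ℕ
  r = fold 0 (g ∘ suc)

  gap : ∀ n → ¬ ¬ Σ ℕ λ z → r n < z × z ≤ r (suc n) × ¬ A z
  gap n = dominator-gap coinf dom (r n)

  r-step : ∀ n → r n ≤ r (suc n)
  r-step n = decidable-stable (r n ≤? r (suc n))
    λ r≰ → gap n λ { (z , rₙ<z , z≤rₙ₊₁ , _) → r≰ (<⇒≤ (<-≤-trans rₙ<z z≤rₙ₊₁)) }

  separated : ∀ {x y} → x < y → ¬ F A (r x) (r y)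
  separated {x} x<y rx~ry = gap x λ { (z , rₓ<z , z≤rₓ₊₁ , z∉A) →
    gap⇒¬F rₓ<z (≤-trans z≤rₓ₊₁ (stepwise-monotone r r-step x<y)) z∉A rx~ry }

  r-reflects : ∀ x y → F A (r x) (r y) → x ≡ y
  r-reflects x y rx~ry with <-cmp x y
  ... | tri< x<y _ _ = ⊥-elim (separated x<y rx~ry)
  ... | tri≈ _ x≡y _ = x≡y
  ... | tri> _ _ y<x = ⊥-elim (separated y<x (F-sym rx~ry))

proposition5p6 : (A : ℕ → Set) → CE A → CoInfinite A →
    ((ω ≤ᶜ F A) ⇔ NotHypersimple A)
proposition5p6 A _ coinf = mk⇔ dominator-of-reduction reduction-of-dominator
  where
  dominator-of-reduction : ω ≤ᶜ F A → NotHypersimple A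
  dominator-of-reduction (f , f-computable , reduces) =
    dominator , computable-dominator f-computable , dominates
    where open Forward A (λ x y → Equivalence.from (reduces x y))

  reduction-of-dominator : NotHypersimple A → ω ≤ᶜ F A
  reduction-of-dominator (g , g-computable , dom) =
    r , computable-fold 0 (computable-∘ g-computable computable-suc) ,
    λ x y → mk⇔ (inj₁ ∘ cong r) (r-reflects x y)
    where open Backward A coinf dom
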